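{- Let $M$ be a positive totally ordered monoid and let $a,b\in M$ be commensurable. If $a$ absorbs $b$ on the left ($a+b=a$) or on the right ($b+a=a$), then $a=nb$ for some positive integer $n$, and in particular $b$ is a generalized idempotent.
   Context: $M$ is a monoid, written additively with unit $0$ and not necessarily commutative, with a relation $\le$ which, for all $a,b,c\in M$, is transitive, antisymmetric and total, satisfies $0\le a$, and satisfies $a\le b\Rightarrow a+c\le b+c$ and $c+a\le c+b$. Here $nb=b+\dots+b$ ($n$ summands). Elements $a,b$ are commensurable if $a\le nb$ and $b\le ma$ for some positive integers $n,m$. An element $b$ is a generalized idempotent if $nb=mb$ for some positive integers $n\ne m$. -}

module Defs where

open import Level using (Level; suc; _⊔_)
open import Data.Nat using (ℕ; zero) renaming (suc to sucℕ)
open import Data.Product using (Σ; _×_; ∃)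
open import Relation.Binary.PropositionalEquality using (_≡_)
open import Relation.Nullary using (¬_)
open import Algebra.Structures using (IsMonoid)
open import Relation.Binary.Definitions using (Transitive; Antisymmetric; Total)

record PosTotOrdMonoid (c ℓ : Level) : Set (suc (c ⊔ ℓ)) where
  infixl 6 _+_
  infix 4 _≤_
  field
    Carrier   : Set c
    _+_       : Carrier → Carrier → Carrier
    0#        : Carrier
    _≤_       : Carrier → Carrier → Set ℓ
    isMonoid  : IsMonoid _≡_ _+_ 0#
    ≤-trans   : Transitive _≤_
    ≤-antisym : Antisymmetric _≡_ _≤_
    ≤-total   : Total _≤_
    0≤        : ∀ a → 0# ≤ a
    +-monoˡ   : ∀ {a b} c → a ≤ b → a + c ≤ b + c
    +-monoʳ   : ∀ {a b} c → a ≤ b → c + a ≤ c + b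

  infixr 7 _•_
  _•_ : ℕ → Carrier → Carrier
  zero • b = 0#
  sucℕ zero • b = b
  sucℕ (sucℕ n) • b = (sucℕ n • b) + b

  Commensurable : Carrier → Carrier → Set ℓ
  Commensurable a b =
    Σ ℕ (λ n → Σ ℕ (λ m → (a ≤ sucℕ n • b) × (b ≤ sucℕ m • a)))

  GeneralizedIdempotent : Carrier → Set c
  GeneralizedIdempotent b =
    Σ ℕ (λ n → Σ ℕ (λ m → (¬ n ≡ m) × (sucℕ n • b ≡ sucℕ m • b)))

-- Say that a absorbs x when a + x = a or x + a = a.  The argument has three
-- steps, each a general fact about positive totally ordered monoids:
--   * absorption is inherited by multiples: if a absorbs b, then a absorbs
--     every positive multiple (k+1) b (both sides by associativity, the
--     left-sided case also using that b commutes with its own multiples);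
--   * positivity gives x ≤ a + x and x ≤ x + a, so anything a absorbs lies
--     below a;
--   * if (n+1) b absorbs b, then (n+2) b = (n+1) b.
-- For commensurable a, b we have a ≤ (n+1) b for some n; the first two steps
-- give (n+1) b ≤ a, so a = (n+1) b by antisymmetry, and the third step shows
-- that b is a generalized idempotent, witnessed by n+2 ≠ n+1.
module Submission where

open import Defs
open import Level using (Level)
open import Data.Nat using (ℕ; suc; zero)
open import Data.Nat.Properties using (1+n≢n)
open import Data.Product using (Σ; _×_; _,_)
open import Data.Sum using (_⊎_; inj₁; inj₂)
open import Relation.Binary.PropositionalEquality
  using (_≡_; refl; sym; trans; cong; subst; module ≡-Reasoning)
open import Algebra.Structures using (IsMonoid)

module Absorption {c ℓ : Level} (M : PosTotOrdMonoid c ℓ) where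
  open PosTotOrdMonoid M
  open IsMonoid isMonoid using (assoc; identityˡ; identityʳ)
  open ≡-Reasoning

  Absorbs : Carrier → Carrier → Set c
  Absorbs a x = a + x ≡ a ⊎ x + a ≡ a

  ≤-+ʳ : ∀ x y → x ≤ x + y
  ≤-+ʳ x y = subst (_≤ x + y) (identityʳ x) (+-monoʳ x (0≤ y))

  ≤-+ˡ : ∀ x y → x ≤ y + x
  ≤-+ˡ x y = subst (_≤ y + x) (identityˡ x) (+-monoˡ x (0≤ y))

  absorbed⇒≤ : ∀ {a x} → Absorbs a x → x ≤ a
  absorbed⇒≤ {a} {x} (inj₁ a+x≡a) = subst (x ≤_) a+x≡a (≤-+ˡ x a)
  absorbed⇒≤ {a} {x} (inj₂ x+a≡a) = subst (x ≤_) x+a≡a (≤-+ʳ x a)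

  -- Multiples of b commute with b; needed because _•_ adds b on the right.
  •-comm : ∀ b k → b + suc k • b ≡ suc k • b + b
  •-comm b zero    = refl
  •-comm b (suc k) = begin
    b + (suc k • b + b)  ≡⟨ sym (assoc b (suc k • b) b) ⟩
    (b + suc k • b) + b  ≡⟨ cong (_+ b) (•-comm b k) ⟩
    (suc k • b + b) + b  ∎

  absorbsʳ-• : ∀ {a b} → a + b ≡ a → ∀ k → a + suc k • b ≡ a
  absorbsʳ-• a+b≡a zero    = a+b≡a
  absorbsʳ-• {a} {b} a+b≡a (suc k) = begin
    a + (suc k • b + b)  ≡⟨ sym (assoc a (suc k • b) b) ⟩
    (a + suc k • b) + b  ≡⟨ cong (_+ b) (absorbsʳ-• a+b≡a k) ⟩
    a + b                ≡⟨ a+b≡a ⟩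
    a                    ∎

  absorbsˡ-• : ∀ {a b} → b + a ≡ a → ∀ k → suc k • b + a ≡ a
  absorbsˡ-• b+a≡a zero    = b+a≡a
  absorbsˡ-• {a} {b} b+a≡a (suc k) = begin
    (suc k • b + b) + a  ≡⟨ assoc (suc k • b) b a ⟩
    suc k • b + (b + a)  ≡⟨ cong (suc k • b +_) b+a≡a ⟩
    suc k • b + a        ≡⟨ absorbsˡ-• b+a≡a k ⟩
    a                    ∎

  absorbs-• : ∀ {a b} → Absorbs a b → ∀ k → Absorbs a (suc k • b)
  absorbs-• (inj₁ a+b≡a) k = inj₁ (absorbsʳ-• a+b≡a k)
  absorbs-• (inj₂ b+a≡a) k = inj₂ (absorbsˡ-• b+a≡a k)

  absorbing-multiple : ∀ b n → Absorbs (suc n • b) b →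
                       suc (suc n) • b ≡ suc n • b
  absorbing-multiple b n (inj₁ nb+b≡nb) = nb+b≡nb
  absorbing-multiple b n (inj₂ b+nb≡nb) = trans (sym (•-comm b n)) b+nb≡nb

open Absorption using (Absorbs; absorbed⇒≤; absorbs-•; absorbing-multiple)

proposition4 : {c ℓ : Level} (M : PosTotOrdMonoid c ℓ) →
    let open PosTotOrdMonoid M in
    (a b : Carrier) → Commensurable a b →
    (a + b ≡ a ⊎ b + a ≡ a) →
    Σ ℕ (λ n → a ≡ suc n • b) × GeneralizedIdempotent b
proposition4 M a b (n , _ , a≤nb , _) a-absorbs-b =
  (n , a≡nb) , (suc n , n , 1+n≢n , absorbing-multiple M b n nb-absorbs-b)
  where
  open PosTotOrdMonoid M
  nb≤a : suc n • b ≤ a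
  nb≤a = absorbed⇒≤ M (absorbs-• M a-absorbs-b n)

  a≡nb : a ≡ suc n • b
  a≡nb = ≤-antisym a≤nb nb≤a

  nb-absorbs-b : Absorbs M (suc n • b) b
  nb-absorbs-b = subst (λ x → Absorbs M x b) a≡nb a-absorbs-b
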